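{- For every $n\geq 1$, the set of words encoding the states of the $n$-foil $F_n$ with exactly one component equals the set $\mathcal{T}_n$ of words encoding the states of the $n$-twist loop $T_n$ with exactly two components.
   Context: Splitting a crossing of a plane curve means deleting a small neighbourhood of it and reconnecting the four loose ends by two disjoint arcs; a state is obtained by splitting every crossing and is a disjoint union of simple closed curves. A state is encoded by the word $\sigma_1\cdots\sigma_n$ with $\sigma_i=0$ if the $A$-split was applied at the $i$-th crossing and $\sigma_i=1$ for the $B$-split. For $n\ge1$ let $R_n$ be a horizontal twist region: two strands running left to right crossing each other $n$ times consecutively at $c_1,\dots,c_n$ (left to right), with ends NW, SW (left) and NE, SE (right); each crossing has a top, bottom, left and right corner. The $n$-twist loop $T_n$ is obtained by joining NW to SW by an arc on the left and NE to SE on the right; at each crossing the top and bottom corners lie in the unbounded region, the $A$-split merges these two corners and the $B$-split merges the left and right corners (lying in lobes). The $n$-foil $F_n$ is obtained by joining NW to NE by an arc above $R_n$ and SW to SE by an arc below $R_n$; the region above $R_n$ and the region below $R_n$ (containing the top, resp. bottom, corners of all crossings) are the $A$-regions (viewing the shadow on the sphere so one of them is unbounded), so the $A$-split at $c_i$ merges its top and bottom corners and the $B$-split merges its left and right corners. -}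

module Defs where

open import Data.Bool using (Bool; true; false; _∧_; _∨_; not; if_then_else_)
open import Data.Nat using (ℕ; zero; suc; _∸_; _≡ᵇ_)
open import Data.Fin using (Fin; toℕ)
open import Data.List using (List; []; _∷_; length; concatMap; allFin)
open import Data.Bool.ListAction using (any)
open import Data.List.Base using () renaming (filterᵇ to filter)
open import Data.Product using (_×_; _,_; proj₁; proj₂)
open import Data.Vec using (Vec; lookup)

-- The four loose ends of a crossing c_i of the twist region R_n
-- (positions around the crossing).
data End : Set where
  nw ne sw se : End

endEq : End → End → Bool
endEq nw nw = true
endEq ne ne = true
endEq sw sw = true
endEq se se = true
endEq _  _  = false

-- Vertex (i , e): the end e of the crossing c_(i+1).
Vertex : ℕ → Set
Vertex n = Fin n × End

veq : ∀ {n} → Vertex n → Vertex n → Bool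
veq (i , a) (j , b) = (toℕ i ≡ᵇ toℕ j) ∧ endEq a b

vertices : ∀ n → List (Vertex n)
vertices n = concatMap (λ i → (i , nw) ∷ (i , ne) ∷ (i , sw) ∷ (i , se) ∷ []) (allFin n)

Edge : ℕ → Set
Edge n = Vertex n × Vertex n

adj : ∀ {n} → List (Edge n) → Vertex n → Vertex n → Bool
adj es u v = any (λ e → (veq (proj₁ e) u ∧ veq (proj₂ e) v) ∨ (veq (proj₂ e) u ∧ veq (proj₁ e) v)) es

reachable : ∀ {n} → List (Edge n) → ℕ → Vertex n → List (Vertex n)
reachable es zero    u = u ∷ []
reachable {n} es (suc k) u = let R = reachable es k u in
  filter (λ v → any (λ w → veq w v ∨ adj es w v) R) (vertices n)

connected : ∀ {n} → List (Edge n) → Vertex n → Vertex n → Bool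
connected {n} es u v = any (veq v) (reachable es (length (vertices n)) u)

countComps : ∀ {n} → List (Edge n) → List (Vertex n) → List (Vertex n) → ℕ
countComps es reps [] = 0
countComps es reps (v ∷ vs) =
  if any (connected es v) reps
  then countComps es reps vs
  else suc (countComps es (v ∷ reps) vs)

components : ∀ {n} → List (Edge n) → ℕ
components {n} es = countComps es [] (vertices n)

regionArcs : ∀ n → List (Edge n)
regionArcs n = concatMap (λ i → concatMap (λ j →
  if toℕ j ≡ᵇ suc (toℕ i)
  then ((i , ne) , (j , nw)) ∷ ((i , se) , (j , sw)) ∷ []
  else []) (allFin n)) (allFin n)

-- Arcs produced by splitting every crossing according to the word σ
-- (false = 0 = A-split: arcs NW–SW and NE–SE, merging top and bottom corners;
--  true  = 1 = B-split: arcs NW–NE and SW–SE, merging left and right corners).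
splitArcs : ∀ {n} → Vec Bool n → List (Edge n)
splitArcs {n} σ = concatMap (λ i →
  if lookup σ i
  then ((i , nw) , (i , ne)) ∷ ((i , sw) , (i , se)) ∷ []
  else ((i , nw) , (i , sw)) ∷ ((i , ne) , (i , se)) ∷ []) (allFin n)

twistClosure : ∀ n → List (Edge n)
twistClosure n = concatMap (λ i →
  (if toℕ i ≡ᵇ 0 then ((i , nw) , (i , sw)) ∷ [] else []))
  (allFin n)
  Data.List.++ concatMap (λ i →
  (if toℕ i ≡ᵇ (n ∸ 1) then ((i , ne) , (i , se)) ∷ [] else []))
  (allFin n)

foilClosure : ∀ n → List (Edge n)
foilClosure n = concatMap (λ i → concatMap (λ j →
  if (toℕ i ≡ᵇ 0) ∧ (toℕ j ≡ᵇ (n ∸ 1))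
  then ((i , nw) , (j , ne)) ∷ ((i , sw) , (j , se)) ∷ []
  else []) (allFin n)) (allFin n)

-- The state of T_n / F_n encoded by the word σ, as a graph whose
-- connected components are the circles of the state.
twistState : ∀ {n} → Vec Bool n → List (Edge n)
twistState {n} σ = twistClosure n Data.List.++ regionArcs n Data.List.++ splitArcs σ

foilState : ∀ {n} → Vec Bool n → List (Edge n)
foilState {n} σ = foilClosure n Data.List.++ regionArcs n Data.List.++ splitArcs σ

module Submission where

-- We
-- never compute connectivity directly: we exhibit a representative map
-- (constant along arcs, idempotent, joining each end to its image, never
-- moving an end later in the scan), and then `components` is its number of
-- fixed points (`components-by-representatives`).
--
-- Let p be the number of A-splits in σ.  A B-split continues both strands to
-- the next gap between crossings; an A-split ends the top and bottom pieces
-- and joins them.  In T_n every gap is represented by the NE end of the last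
-- A-split to its left (or NW of c_1), so T_n has p + 1 circles
-- (`Twist.twist-components`).  In F_n the closure glues gap n to gap 0, so
-- the pieces after the last A-split wrap round; F_n has
-- 1 + #(A-splits other than the last) + [p = 0] circles
-- (`Foil.foil-components`), which is 1 exactly when p = 1.  So both sides of
-- the theorem say p = 1.

open import Defs
open import Data.Bool using (Bool; true; false; _∧_; _∨_; not; if_then_else_; T?)
open import Data.Bool.Properties using (T-≡; ∧-zeroʳ; ∧-identityʳ; not-injective)
open import Data.Bool.ListAction using (any)
open import Data.Empty using (⊥-elim)
open import Data.Fin as Fin using (Fin; toℕ; fromℕ<)
import Data.Fin.Properties as Finₚ
open import Data.List using (List; []; _∷_; _++_; length; concatMap; allFin; tabulate)
open import Data.List.Base using () renaming (filterᵇ to filter)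
open import Data.List.Membership.Propositional using (_∈_; _∉_; find; lose)
open import Data.List.Membership.Propositional.Properties
  using (∈-++⁺ˡ; ∈-++⁺ʳ; ∈-++⁻; ∈-allFin; ∈-concatMap⁺; ∈-concatMap⁻; ∈-filter⁺; ∈-filter⁻)
open import Data.List.Properties using (length-filter; filter-++; filter-accept; filter-reject; length-++)
open import Data.List.Relation.Unary.All as All using (All; []; _∷_)
open import Data.List.Relation.Unary.AllPairs using (AllPairs; []; _∷_)
open import Data.List.Relation.Unary.AllPairs.Properties using (++⁺; tabulate⁺-<)
open import Data.List.Relation.Unary.Any as Any using (here; there)
open import Data.List.Relation.Unary.Any.Properties using (any⁺; any⁻)
open import Data.Nat using (ℕ; zero; suc; _+_; _*_; _≤_; _<_; z≤n; s≤s; z<s; s<s; s≤s⁻¹; _≤′_; ≤′-refl; ≤′-step; _∸_; _≡ᵇ_; _<ᵇ_; _≤?_; _<?_)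
open import Data.Nat.Properties
open import Data.Product using (_×_; _,_; proj₁; proj₂; ∃-syntax)
open import Data.Sum using (_⊎_; inj₁; inj₂; [_,_]′)
open import Data.Vec using (Vec; lookup)
open import Function using (_∘_; case_of_)
open import Function.Bundles using (_⇔_; mk⇔; Equivalence)
open import Relation.Nullary using (Dec; yes; no)
open import Relation.Binary.PropositionalEquality using (_≡_; _≢_; refl; sym; trans; cong; cong₂; subst; subst₂; module ≡-Reasoning)

open Equivalence using (to; from)
open import Algebra.Properties.CommutativeSemigroup +-commutativeSemigroup
  using () renaming (interchange to +-interchange)

∧-true⁻ : ∀ {x y} → (x ∧ y) ≡ true → x ≡ true × y ≡ true
∧-true⁻ {true} {true} refl = refl , refl

∨-true⁻ : ∀ {x y} → (x ∨ y) ≡ true → x ≡ true ⊎ y ≡ true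
∨-true⁻ {true}  _ = inj₁ refl
∨-true⁻ {false} p = inj₂ p

∨-trueˡ : ∀ {x} y → x ≡ true → (x ∨ y) ≡ true
∨-trueˡ _ refl = refl

∨-trueʳ : ∀ x {y} → y ≡ true → (x ∨ y) ≡ true
∨-trueʳ true  _ = refl
∨-trueʳ false p = p

true≢false : true ≢ false
true≢false ()

any-witness : ∀ {A : Set} (p : A → Bool) xs → any p xs ≡ true → ∃[ x ] x ∈ xs × p x ≡ true
any-witness p xs e with find (Any.map (to T-≡) (any⁻ p xs (from T-≡ e)))
... | x , x∈xs , px = x , x∈xs , px

any-intro : ∀ {A : Set} (p : A → Bool) {x} xs → x ∈ xs → p x ≡ true → any p xs ≡ true
any-intro p xs x∈xs px = to T-≡ (any⁺ p (lose x∈xs (from T-≡ px)))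

any-none : ∀ {A : Set} (p : A → Bool) xs → (∀ x → x ∈ xs → p x ≢ true) → any p xs ≡ false
any-none p xs none with any p xs in eq
... | false = refl
... | true  = let x , x∈xs , px = any-witness p xs eq in ⊥-elim (none x x∈xs px)

filter-∈⁻ : ∀ {A : Set} (p : A → Bool) xs {x} → x ∈ filter p xs → x ∈ xs × p x ≡ true
filter-∈⁻ p xs m with ∈-filter⁻ (T? ∘ p) m
... | x∈xs , px = x∈xs , to T-≡ px

filter-∈⁺ : ∀ {A : Set} (p : A → Bool) xs {x} → x ∈ xs → p x ≡ true → x ∈ filter p xs
filter-∈⁺ p xs x∈xs px = ∈-filter⁺ (T? ∘ p) x∈xs (from T-≡ px)

concatMap-∈⁺ : ∀ {A B : Set} (f : A → List B) {xs a b} → a ∈ xs → b ∈ f a → b ∈ concatMap f xs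
concatMap-∈⁺ f a∈xs b∈fa = ∈-concatMap⁺ f (lose a∈xs b∈fa)

concatMap-∈⁻ : ∀ {A B : Set} (f : A → List B) xs {b} → b ∈ concatMap f xs → ∃[ a ] a ∈ xs × b ∈ f a
concatMap-∈⁻ f xs m = find (∈-concatMap⁻ f m)

if-∈⁻ : ∀ {A : Set} b {L : List A} {x} → x ∈ (if b then L else []) → b ≡ true × x ∈ L
if-∈⁻ true m = refl , m

if-∈⁺ : ∀ {A : Set} {b} {L₁ L₂ : List A} {x} → (b ≡ true × x ∈ L₁) ⊎ (b ≡ false × x ∈ L₂) →
  x ∈ (if b then L₁ else L₂)
if-∈⁺ (inj₁ (refl , m)) = m
if-∈⁺ (inj₂ (refl , m)) = m

∈-pair : ∀ {A : Set} {x a b : A} → x ∈ (a ∷ b ∷ []) → x ≡ a ⊎ x ≡ b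
∈-pair (here p)         = inj₁ p
∈-pair (there (here p)) = inj₂ p

length-filter-mono : ∀ {A : Set} (p q : A → Bool) xs → (∀ x → x ∈ xs → p x ≡ true → q x ≡ true) →
  length (filter p xs) ≤ length (filter q xs)
length-filter-mono p q [] h = z≤n
length-filter-mono p q (y ∷ ys) h with p y in py | q y in qy
... | true  | true  = s≤s (length-filter-mono p q ys (λ x m → h x (there m)))
... | true  | false = ⊥-elim (true≢false (trans (sym (h y (here refl) py)) qy))
... | false | true  = m≤n⇒m≤1+n (length-filter-mono p q ys (λ x m → h x (there m)))
... | false | false = length-filter-mono p q ys (λ x m → h x (there m))

length-filter-strict : ∀ {A : Set} (p q : A → Bool) xs → (∀ x → x ∈ xs → p x ≡ true → q x ≡ true) →
  ∀ z → z ∈ xs → p z ≡ false → q z ≡ true → length (filter p xs) < length (filter q xs)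
length-filter-strict p q (y ∷ ys) h z (here refl) pz qz rewrite pz | qz =
  s≤s (length-filter-mono p q ys (λ x m → h x (there m)))
length-filter-strict p q (y ∷ ys) h z (there z∈ys) pz qz with p y in py | q y in qy
... | true  | true  = s≤s (length-filter-strict p q ys (λ x m → h x (there m)) z z∈ys pz qz)
... | true  | false = ⊥-elim (true≢false (trans (sym (h y (here refl) py)) qy))
... | false | true  = m≤n⇒m≤1+n (length-filter-strict p q ys (λ x m → h x (there m)) z z∈ys pz qz)
... | false | false = length-filter-strict p q ys (λ x m → h x (there m)) z z∈ys pz qz

length-filter-pos : ∀ {A : Set} (p : A → Bool) xs {x} → x ∈ xs → p x ≡ true → 1 ≤ length (filter p xs)
length-filter-pos p xs x∈xs px with filter p xs | filter-∈⁺ p xs x∈xs px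
... | _ ∷ _ | _ = s≤s z≤n

filter-accept′ : ∀ {A : Set} (p : A → Bool) {x xs} → p x ≡ true → filter p (x ∷ xs) ≡ x ∷ filter p xs
filter-accept′ p px = filter-accept (T? ∘ p) (from T-≡ px)

filter-reject′ : ∀ {A : Set} (p : A → Bool) {x xs} → p x ≡ false → filter p (x ∷ xs) ≡ filter p xs
filter-reject′ p px = filter-reject (T? ∘ p) (λ t → true≢false (trans (sym (to T-≡ t)) px))

≡ᵇ-true⇒≡ : ∀ m n → (m ≡ᵇ n) ≡ true → m ≡ n
≡ᵇ-true⇒≡ m n e = ≡ᵇ⇒≡ m n (from T-≡ e)

≡ᵇ-refl : ∀ m → (m ≡ᵇ m) ≡ true
≡ᵇ-refl m = to T-≡ (≡⇒≡ᵇ m m refl)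

≢⇒≡ᵇ-false : ∀ m n → m ≢ n → (m ≡ᵇ n) ≡ false
≢⇒≡ᵇ-false m n m≢n with m ≡ᵇ n in eq
... | true  = ⊥-elim (m≢n (≡ᵇ-true⇒≡ m n eq))
... | false = refl

<ᵇ-true⇒< : ∀ m n → (m <ᵇ n) ≡ true → m < n
<ᵇ-true⇒< m n e = <ᵇ⇒< m n (from T-≡ e)

<⇒<ᵇ-true : ∀ {m n} → m < n → (m <ᵇ n) ≡ true
<⇒<ᵇ-true m<n = to T-≡ (<⇒<ᵇ m<n)

<ᵇ-false⇒≥ : ∀ m n → (m <ᵇ n) ≡ false → n ≤ m
<ᵇ-false⇒≥ m n e = ≮⇒≥ (λ m<n → true≢false (trans (sym (<⇒<ᵇ-true m<n)) e))

≥⇒<ᵇ-false : ∀ {m n} → n ≤ m → (m <ᵇ n) ≡ false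
≥⇒<ᵇ-false {m} {n} n≤m with m <ᵇ n in e
... | true  = ⊥-elim (<⇒≱ (<ᵇ-true⇒< m n e) n≤m)
... | false = refl

<ᵇ-irrefl : ∀ k → (k <ᵇ k) ≡ false
<ᵇ-irrefl zero    = refl
<ᵇ-irrefl (suc k) = <ᵇ-irrefl k

≡ᵇ0-sym : ∀ t → (0 ≡ᵇ t) ≡ (t ≡ᵇ 0)
≡ᵇ0-sym zero    = refl
≡ᵇ0-sym (suc t) = refl

pos⇒≡ᵇ0-false : ∀ {t} → 0 < t → (t ≡ᵇ 0) ≡ false
pos⇒≡ᵇ0-false {suc t} _ = refl

endEq⇒≡ : ∀ a b → endEq a b ≡ true → a ≡ b
endEq⇒≡ nw nw _ = refl
endEq⇒≡ ne ne _ = refl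
endEq⇒≡ sw sw _ = refl
endEq⇒≡ se se _ = refl

endEq-refl : ∀ a → endEq a a ≡ true
endEq-refl nw = refl
endEq-refl ne = refl
endEq-refl sw = refl
endEq-refl se = refl

veq⇒≡ : ∀ {n} (x y : Vertex n) → veq x y ≡ true → x ≡ y
veq⇒≡ (i , a) (j , b) e with ∧-true⁻ {toℕ i ≡ᵇ toℕ j} e
... | i≡j , a≡b = cong₂ _,_ (Finₚ.toℕ-injective (≡ᵇ-true⇒≡ _ _ i≡j)) (endEq⇒≡ a b a≡b)

veq-refl : ∀ {n} (x : Vertex n) → veq x x ≡ true
veq-refl (i , a) rewrite ≡ᵇ-refl (toℕ i) = endEq-refl a

≢⇒veq-false : ∀ {n} (x y : Vertex n) → x ≢ y → veq x y ≡ false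
≢⇒veq-false x y x≢y with veq x y in eq
... | true  = ⊥-elim (x≢y (veq⇒≡ x y eq))
... | false = refl

_≟V_ : ∀ {n} (x y : Vertex n) → Dec (x ≡ y)
x ≟V y with veq x y in eq
... | true  = yes (veq⇒≡ x y eq)
... | false = no (λ { refl → true≢false (trans (sym (veq-refl x)) eq) })

memberᵇ : ∀ {n} → Vertex n → List (Vertex n) → Bool
memberᵇ v L = any (veq v) L

memberᵇ⇒∈ : ∀ {n} (v : Vertex n) L → memberᵇ v L ≡ true → v ∈ L
memberᵇ⇒∈ v L e with any-witness (veq v) L e
... | x , x∈L , v≡x rewrite veq⇒≡ v x v≡x = x∈L

∈⇒memberᵇ : ∀ {n} (v : Vertex n) L → v ∈ L → memberᵇ v L ≡ true
∈⇒memberᵇ v L v∈L = any-intro (veq v) L v∈L (veq-refl v)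

endsOf : ∀ {n} → Fin n → List (Vertex n)
endsOf i = (i , nw) ∷ (i , ne) ∷ (i , sw) ∷ (i , se) ∷ []

∈-vertices : ∀ {n} (v : Vertex n) → v ∈ vertices n
∈-vertices (i , e) = concatMap-∈⁺ endsOf (∈-allFin i) (position e)
  where
  position : ∀ e → (i , e) ∈ endsOf i
  position nw = here refl
  position ne = there (here refl)
  position sw = there (there (here refl))
  position se = there (there (there (here refl)))

code : End → ℕ
code nw = 0
code ne = 1
code sw = 2
code se = 3

code≤3 : ∀ e → code e ≤ 3
code≤3 nw = z≤n
code≤3 ne = s≤s z≤n
code≤3 sw = s≤s (s≤s z≤n)
code≤3 se = s≤s (s≤s (s≤s z≤n))

rank : ℕ → End → ℕ
rank k e = k * 4 + code e

ord : ∀ {n} → Vertex n → ℕ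
ord (i , e) = rank (toℕ i) e

rank-<-crossing : ∀ {j k} e e′ → j < k → rank j e < rank k e′
rank-<-crossing {zero}  {suc k} e e′ _ = ≤-trans (s≤s (code≤3 e)) (m≤m+n 4 (rank k e′))
rank-<-crossing {suc j} {suc k} e e′ (s≤s j<k) = +-monoʳ-< 4 (rank-<-crossing e e′ j<k)

rank-ne≤ : ∀ {j k} e → j ≤ k → 1 ≤ code e → rank j ne ≤ rank k e
rank-ne≤ {zero}  {zero}  e _ c = c
rank-ne≤ {zero}  {suc k} e _ c = s≤s z≤n
rank-ne≤ {suc j} {suc k} e (s≤s j≤k) c = +-monoʳ-≤ 4 (rank-ne≤ e j≤k c)

Sorted : ∀ {n} → List (Vertex n) → Set
Sorted = AllPairs (λ x y → ord x < ord y)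

-- The enumeration is strictly increasing in `ord`, so `ord` decides which
-- of two ends `components` meets first.
vertices-sorted : ∀ n → Sorted (vertices n)
vertices-sorted n = blocks (allFin n) (tabulate⁺-< (λ i<j → i<j))
  where
  within : ∀ i e e′ → code e < code e′ → ord (i , e) < ord (i , e′)
  within i _ _ lt = +-monoʳ-< (toℕ i * 4) lt
  ends-sorted : ∀ i → Sorted (endsOf i)
  ends-sorted i = (within i nw ne z<s ∷ within i nw sw z<s ∷ within i nw se z<s ∷ [])
                ∷ (within i ne sw (s<s z<s) ∷ within i ne se (s<s z<s) ∷ [])
                ∷ (within i sw se (s<s (s<s z<s)) ∷ []) ∷ [] ∷ []
  crossing : ∀ {k : Fin n} {v} → v ∈ endsOf k → proj₁ v ≡ k
  crossing (here refl) = refl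
  crossing (there (here refl)) = refl
  crossing (there (there (here refl))) = refl
  crossing (there (there (there (here refl)))) = refl
  later : ∀ {i j} → toℕ i < toℕ j → ∀ {x y} → x ∈ endsOf i → y ∈ endsOf j → ord x < ord y
  later lt {_ , e} {_ , e′} x∈ y∈ =
    rank-<-crossing e e′ (subst₂ (λ a b → toℕ a < toℕ b) (sym (crossing x∈)) (sym (crossing y∈)) lt)
  blocks : ∀ is → AllPairs (λ i j → toℕ i < toℕ j) is → Sorted (concatMap endsOf is)
  blocks [] [] = []
  blocks (i ∷ is) (i<is ∷ is↑) =
    ++⁺ (ends-sorted i) (blocks is is↑)
        (All.tabulate (λ x∈ → All.tabulate (λ y∈ →
          let j , j∈is , y∈j = concatMap-∈⁻ endsOf is y∈ in later (All.lookup i<is j∈is) x∈ y∈j)))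

∧-true⁺ : ∀ {x y} → x ≡ true → y ≡ true → (x ∧ y) ≡ true
∧-true⁺ refl refl = refl

⊆-or-missing : ∀ {n} (L₁ L₂ : List (Vertex n)) →
  (∀ x → x ∈ L₁ → x ∈ L₂) ⊎ (∃[ x ] x ∈ L₁ × memberᵇ x L₂ ≡ false)
⊆-or-missing [] L₂ = inj₁ (λ _ ())
⊆-or-missing (y ∷ L₁) L₂ with memberᵇ y L₂ in y∈? | ⊆-or-missing L₁ L₂
... | false | _ = inj₂ (y , here refl , y∈?)
... | true  | inj₂ (x , x∈ , x∉) = inj₂ (x , there x∈ , x∉)
... | true  | inj₁ L₁⊆L₂ = inj₁ λ { x (here refl) → memberᵇ⇒∈ y L₂ y∈? ; x (there m) → L₁⊆L₂ x m }

module Reachability {n : ℕ} (es : List (Edge n)) where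

  N : ℕ
  N = length (vertices n)

  Ball : ℕ → Vertex n → List (Vertex n)
  Ball k u = reachable es k u

  step⁻ : ∀ k u x → x ∈ Ball (suc k) u → ∃[ w ] w ∈ Ball k u × (veq w x ∨ adj es w x) ≡ true
  step⁻ k u x m = any-witness _ (Ball k u) (proj₂ (filter-∈⁻ _ (vertices n) m))

  step⁺ : ∀ k u x w → w ∈ Ball k u → (veq w x ∨ adj es w x) ≡ true → x ∈ Ball (suc k) u
  step⁺ k u x w m p =
    filter-∈⁺ _ (vertices n) (∈-vertices x) (any-intro (λ w → veq w x ∨ adj es w x) (Ball k u) m p)

  ball-mono : ∀ {k l} u x → k ≤ l → x ∈ Ball k u → x ∈ Ball l u
  ball-mono u x k≤l m = grow (≤⇒≤′ k≤l)
    where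
    grow : ∀ {l} → _ ≤′ l → x ∈ Ball l u
    grow ≤′-refl = m
    grow (≤′-step {l} p) = step⁺ l u x x (grow p) (∨-trueˡ _ (veq-refl x))

  ball-trans : ∀ k l u w v → w ∈ Ball k u → v ∈ Ball l w → v ∈ Ball (k + l) u
  ball-trans k zero u w v w∈ (here refl) = subst (λ z → v ∈ Ball z u) (sym (+-identityʳ k)) w∈
  ball-trans k (suc l) u w v w∈ v∈ with step⁻ l w v v∈
  ... | x , x∈ , xv = subst (λ z → v ∈ Ball z u) (sym (+-suc k l))
                        (step⁺ (k + l) u v x (ball-trans k l u w x w∈ x∈) xv)

  Connected : Vertex n → Vertex n → Set
  Connected u v = ∃[ k ] v ∈ Ball k u

  connected-refl : ∀ u → Connected u u
  connected-refl u = 0 , here refl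

  connected-trans : ∀ {u w v} → Connected u w → Connected w v → Connected u v
  connected-trans (k , w∈) (l , v∈) = k + l , ball-trans k l _ _ _ w∈ v∈

  adj→connected : ∀ {u v} → adj es u v ≡ true → Connected u v
  adj→connected {u} {v} p = 1 , step⁺ 0 u v u (here refl) (∨-trueʳ (veq u v) p)

  arc→connected : ∀ {a b} → (a , b) ∈ es → Connected a b
  arc→connected {a} {b} m =
    adj→connected (any-intro _ es m (∨-trueˡ _ (∧-true⁺ (veq-refl a) (veq-refl b))))

  arc→connected′ : ∀ {a b} → (a , b) ∈ es → Connected b a
  arc→connected′ {a} {b} m =
    adj→connected (any-intro _ es m (∨-trueʳ (veq a b ∧ veq b a) (∧-true⁺ (veq-refl b) (veq-refl a))))

  Stable : Vertex n → ℕ → Set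
  Stable u j = ∀ x → x ∈ Ball (suc j) u → x ∈ Ball j u

  stable-closed : ∀ {u j} → Stable u j → ∀ i x → x ∈ Ball (i + j) u → x ∈ Ball j u
  stable-closed st zero x m = m
  stable-closed {u} {j} st (suc i) x m with step⁻ (i + j) u x m
  ... | w , w∈ , wx = st x (step⁺ j u x w (stable-closed st i w w∈) wx)

  reached : Vertex n → ℕ → ℕ
  reached u k = length (filter (λ x → memberᵇ x (Ball k u)) (vertices n))

  stable-or-growing : ∀ u k → (∃[ j ] j ≤ k × Stable u j) ⊎ (suc k ≤ reached u k)
  stable-or-growing u zero =
    inj₂ (length-filter-pos _ (vertices n) (∈-vertices u) (∈⇒memberᵇ u (u ∷ []) (here refl)))
  stable-or-growing u (suc k) with stable-or-growing u k
  ... | inj₁ (j , j≤k , st) = inj₁ (j , m≤n⇒m≤1+n j≤k , st)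
  ... | inj₂ k<reached with ⊆-or-missing (Ball (suc k) u) (Ball k u)
  ...   | inj₁ st = inj₁ (k , n≤1+n k , st)
  ...   | inj₂ (x , x∈ , x∉) = inj₂ (≤-<-trans k<reached
          (length-filter-strict _ _ (vertices n)
            (λ y _ y∈ → ∈⇒memberᵇ y _ (ball-mono u y (n≤1+n k) (memberᵇ⇒∈ y _ y∈)))
            x (∈-vertices x) x∉ (∈⇒memberᵇ x _ x∈)))

  -- At most N ends can be reached, so the search stabilises within N rounds.
  stabilises : ∀ u → ∃[ j ] j ≤ N × Stable u j
  stabilises u with stable-or-growing u N
  ... | inj₁ stable = stable
  ... | inj₂ N<reached = ⊥-elim (<-irrefl refl (≤-<-trans (length-filter _ (vertices n)) N<reached))

  ball-within-N : ∀ {u v} k → v ∈ Ball k u → v ∈ Ball N u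
  ball-within-N {u} {v} k v∈ with stabilises u | k ≤? N
  ... | _ | yes k≤N = ball-mono u v k≤N v∈
  ... | j , j≤N , st | no k≰N = ball-mono u v j≤N (stable-closed st (k ∸ j) v v∈′)
    where
    v∈′ : v ∈ Ball (k ∸ j + j) u
    v∈′ = subst (λ z → v ∈ Ball z u) (sym (m∸n+n≡m (≤-trans j≤N (<⇒≤ (≰⇒> k≰N))))) v∈

  Connected⇒connected : ∀ {u v} → Connected u v → connected es u v ≡ true
  Connected⇒connected {u} {v} (k , v∈) = ∈⇒memberᵇ v (Ball N u) (ball-within-N k v∈)

  connected⇒Connected : ∀ {u v} → connected es u v ≡ true → Connected u v
  connected⇒Connected {u} {v} e = N , memberᵇ⇒∈ v (Ball N u) e

-- Then each component has exactly one fixed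
-- point, its first end, and `components` counts these fixed points.
record Representatives {n : ℕ} (es : List (Edge n)) : Set where
  open Reachability es using (Connected)
  field
    rep           : Vertex n → Vertex n
    rep-arc       : ∀ a b → (a , b) ∈ es → rep a ≡ rep b
    rep-idem      : ∀ v → rep (rep v) ≡ rep v
    rep-connected : ∀ v → Connected v (rep v)
    rep-earlier   : ∀ v → ord (rep v) ≤ ord v

  isRep : Vertex n → Bool
  isRep v = veq (rep v) v

module _ {n : ℕ} {es : List (Edge n)} (R : Representatives es) where
  open Representatives R
  open Reachability es

  private
    rep-adj : ∀ w x → adj es w x ≡ true → rep w ≡ rep x
    rep-adj w x e with any-witness _ es e
    ... | (a , b) , ab∈ , q with ∨-true⁻ {veq a w ∧ veq b x} q
    ... | inj₁ r = let a≡w , b≡x = ∧-true⁻ {veq a w} r in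
      subst₂ (λ s t → rep s ≡ rep t) (veq⇒≡ a w a≡w) (veq⇒≡ b x b≡x) (rep-arc a b ab∈)
    ... | inj₂ r = let b≡w , a≡x = ∧-true⁻ {veq b w} r in
      subst₂ (λ s t → rep s ≡ rep t) (veq⇒≡ b w b≡w) (veq⇒≡ a x a≡x) (sym (rep-arc a b ab∈))

    rep-ball : ∀ k u x → x ∈ Ball k u → rep x ≡ rep u
    rep-ball zero u x (here refl) = refl
    rep-ball (suc k) u x m with step⁻ k u x m
    ... | w , w∈ , e with ∨-true⁻ {veq w x} e
    ... | inj₁ w≡x = trans (cong rep (sym (veq⇒≡ w x w≡x))) (rep-ball k u w w∈)
    ... | inj₂ wx  = trans (sym (rep-adj w x wx)) (rep-ball k u w w∈)

    rep-connected-eq : ∀ u v → connected es u v ≡ true → rep u ≡ rep v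
    rep-connected-eq u v e = let k , v∈ = connected⇒Connected e in sym (rep-ball k u v v∈)

    Invariant : List (Vertex n) → List (Vertex n) → Set
    Invariant seen vs = ∀ x → (x ∈ seen → rep x ≡ x × x ∉ vs) × (rep x ≡ x → x ∉ vs → x ∈ seen)

    scanStep : List (Vertex n) → Vertex n → List (Vertex n) → Bool → ℕ
    scanStep seen v vs b = if b then countComps es seen vs else suc (countComps es (v ∷ seen) vs)

    scan : ∀ seen vs → Sorted vs → Invariant seen vs → countComps es seen vs ≡ length (filter isRep vs)
    scan seen [] _ _ = refl
    scan seen (v ∷ vs) (v<vs ∷ vs↑) inv with rep v ≟V v
    ... | no rep-v≢v = begin
        countComps es seen (v ∷ vs) ≡⟨ cong (scanStep seen v vs) joins-seen ⟩
        countComps es seen vs       ≡⟨ scan seen vs vs↑ inv′ ⟩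
        length (filter isRep vs)    ≡⟨ cong length (sym (filter-reject′ isRep (≢⇒veq-false _ _ rep-v≢v))) ⟩
        length (filter isRep (v ∷ vs)) ∎
      where
      open ≡-Reasoning
      -- rep v comes earlier than v, hence has already been seen
      rep-v-passed : rep v ∉ v ∷ vs
      rep-v-passed (here e) = rep-v≢v e
      rep-v-passed (there m) = <⇒≱ (All.lookup v<vs m) (rep-earlier v)
      joins-seen : any (connected es v) seen ≡ true
      joins-seen = any-intro (connected es v) seen (proj₂ (inv (rep v)) (rep-idem v) rep-v-passed)
                     (Connected⇒connected (rep-connected v))
      inv′ : Invariant seen vs
      inv′ x = (λ m → let fixed , x∉ = proj₁ (inv x) m in fixed , x∉ ∘ there) ,
               (λ fixed x∉ → proj₂ (inv x) fixed λ { (here refl) → rep-v≢v fixed ; (there m) → x∉ m })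
    ... | yes rep-v≡v = begin
        countComps es seen (v ∷ vs)         ≡⟨ cong (scanStep seen v vs) new ⟩
        suc (countComps es (v ∷ seen) vs)  ≡⟨ cong suc (scan (v ∷ seen) vs vs↑ inv′) ⟩
        suc (length (filter isRep vs))     ≡⟨ cong length (sym (filter-accept′ isRep isRep-v)) ⟩
        length (filter isRep (v ∷ vs))     ∎
      where
      open ≡-Reasoning
      isRep-v : isRep v ≡ true
      isRep-v = subst (λ z → veq z v ≡ true) (sym rep-v≡v) (veq-refl v)
      v∉vs : v ∉ vs
      v∉vs m = <-irrefl refl (All.lookup v<vs m)
      -- v is a fixed point not yet seen, so it starts a new component
      new : any (connected es v) seen ≡ false
      new = any-none (connected es v) seen λ r r∈ c →
        let r-fixed , r∉ = proj₁ (inv r) r∈ in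
        r∉ (subst (_∈ v ∷ vs) (trans (sym rep-v≡v) (trans (rep-connected-eq v r c) r-fixed)) (here refl))
      inv′ : Invariant (v ∷ seen) vs
      inv′ x = (λ { (here refl) → rep-v≡v , v∉vs
                  ; (there m) → let fixed , x∉ = proj₁ (inv x) m in fixed , x∉ ∘ there }) ,
               (λ fixed x∉ → case x ≟V v of λ
                  { (yes refl) → here refl
                  ; (no x≢v) → there (proj₂ (inv x) fixed λ { (here e) → x≢v e ; (there m) → x∉ m }) })

  components-by-representatives : components es ≡ length (filter isRep (vertices n))
  components-by-representatives =
    scan [] (vertices n) (vertices-sorted n) (λ x → (λ ()) , (λ _ x∉ → ⊥-elim (x∉ (∈-vertices x))))

ind : Bool → ℕ
ind true  = 1
ind false = 0

sumBelow : ℕ → (ℕ → ℕ) → ℕ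
sumBelow zero    f = 0
sumBelow (suc k) f = sumBelow k f + f k

sumBelow-shift : ∀ k f → sumBelow (suc k) f ≡ f 0 + sumBelow k (f ∘ suc)
sumBelow-shift zero    f = +-comm 0 (f 0)
sumBelow-shift (suc k) f rewrite sumBelow-shift k f = +-assoc (f 0) _ _

sumBelow-+ : ∀ k f g → sumBelow k (λ t → f t + g t) ≡ sumBelow k f + sumBelow k g
sumBelow-+ zero    f g = refl
sumBelow-+ (suc k) f g rewrite sumBelow-+ k f g = +-interchange (sumBelow k f) (sumBelow k g) (f k) (g k)

sumBelow-cong : ∀ k {f g} → (∀ t → f t ≡ g t) → sumBelow k f ≡ sumBelow k g
sumBelow-cong zero    f≗g = refl
sumBelow-cong (suc k) f≗g = cong₂ _+_ (sumBelow-cong k f≗g) (f≗g k)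

sumBelow-mono : ∀ k {f g} → (∀ t → f t ≤ g t) → sumBelow k f ≤ sumBelow k g
sumBelow-mono zero    f≤g = z≤n
sumBelow-mono (suc k) f≤g = +-mono-≤ (sumBelow-mono k f≤g) (f≤g k)

sumBelow-zero : ∀ k {f} → (∀ t → f t ≡ 0) → sumBelow k f ≡ 0
sumBelow-zero k {f} f≗0 = trans (sumBelow-cong k f≗0) (zeros k)
  where zeros : ∀ k → sumBelow k (λ _ → 0) ≡ 0
        zeros zero = refl
        zeros (suc k) = trans (+-identityʳ _) (zeros k)

sumBelow-is-zero : ∀ k → sumBelow (suc k) (λ t → ind (t ≡ᵇ 0)) ≡ 1
sumBelow-is-zero zero    = refl
sumBelow-is-zero (suc k) = cong (_+ 0) (sumBelow-is-zero k)

length-filter-∷ : ∀ {A : Set} (p : A → Bool) x xs →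
  length (filter p (x ∷ xs)) ≡ ind (p x) + length (filter p xs)
length-filter-∷ p x xs with p x
... | true  = refl
... | false = refl

countAt : ∀ {n} → (Vertex n → Bool) → Fin n → ℕ
countAt q i = ind (q (i , nw)) + (ind (q (i , ne)) + (ind (q (i , sw)) + ind (q (i , se))))

count-by-crossings : ∀ {n} (q : Vertex n → Bool) (f : ℕ → ℕ) →
  (∀ i → countAt q i ≡ f (toℕ i)) → length (filter q (vertices n)) ≡ sumBelow n f
count-by-crossings {n} q f at-i = go n (λ i → i) f (λ i → at-i _)
  where
  at-ends : ∀ i → length (filter q (endsOf i)) ≡ countAt q i
  at-ends i rewrite length-filter-∷ q (i , nw) ((i , ne) ∷ (i , sw) ∷ (i , se) ∷ [])
                  | length-filter-∷ q (i , ne) ((i , sw) ∷ (i , se) ∷ [])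
                  | length-filter-∷ q (i , sw) ((i , se) ∷ [])
                  | length-filter-∷ q (i , se) []
                  | +-identityʳ (ind (q (i , se))) = refl
  go : ∀ k (h : Fin k → Fin n) (g : ℕ → ℕ) → (∀ i → countAt q (h i) ≡ g (toℕ i)) →
    length (filter q (concatMap endsOf (tabulate h))) ≡ sumBelow k g
  go zero    h g at = refl
  go (suc k) h g at = begin
    length (filter q (endsOf (h Fin.zero) ++ rest))
      ≡⟨ cong length (filter-++ (T? ∘ q) (endsOf (h Fin.zero)) rest) ⟩
    length (filter q (endsOf (h Fin.zero)) ++ filter q rest)
      ≡⟨ length-++ (filter q (endsOf (h Fin.zero))) ⟩
    length (filter q (endsOf (h Fin.zero))) + length (filter q rest)
      ≡⟨ cong₂ _+_ (trans (at-ends (h Fin.zero)) (at Fin.zero)) (go k (h ∘ Fin.suc) (g ∘ suc) (at ∘ Fin.suc)) ⟩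
    g 0 + sumBelow k (g ∘ suc)
      ≡⟨ sym (sumBelow-shift k g) ⟩
    sumBelow (suc k) g ∎
    where
    open ≡-Reasoning
    rest : List (Vertex n)
    rest = concatMap endsOf (tabulate (h ∘ Fin.suc))

-- Fix a word σ of length n = m + 1.  Crossings and gaps are indexed by ℕ:
-- gap g lies just left of crossing c_(g+1), so crossing k separates gaps
-- k and k + 1; gap 0 is left of c_1 and gap n right of c_n.
module Word (m : ℕ) (σ : Vec Bool (suc m)) where

  n : ℕ
  n = suc m

  -- The crossing with index k (clamped to 0 outside the range).
  crossingAt : ℕ → Fin n
  crossingAt k with k <? n
  ... | yes k<n = fromℕ< k<n
  ... | no  _   = Fin.zero

  toℕ-crossingAt : ∀ k → k < n → toℕ (crossingAt k) ≡ k
  toℕ-crossingAt k k<n with k <? n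
  ... | yes k<n′ = Finₚ.toℕ-fromℕ< k<n′
  ... | no  k≮n  = ⊥-elim (k≮n k<n)

  crossingAt-toℕ : ∀ (i : Fin n) → crossingAt (toℕ i) ≡ i
  crossingAt-toℕ i = Finₚ.toℕ-injective (toℕ-crossingAt (toℕ i) (Finₚ.toℕ<n i))

  end : ℕ → End → Vertex n
  end k e = crossingAt k , e

  nw₀ sw₀ : Vertex n
  nw₀ = Fin.zero , nw
  sw₀ = Fin.zero , sw

  isA : ℕ → Bool
  isA k = (k <ᵇ n) ∧ not (lookup σ (crossingAt k))

  isA⇒< : ∀ k → isA k ≡ true → k < n
  isA⇒< k e = <ᵇ-true⇒< k n (proj₁ (∧-true⁻ {k <ᵇ n} e))

  isA-letter : ∀ k → k < n → isA k ≡ not (lookup σ (crossingAt k))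
  isA-letter k k<n = cong (_∧ not (lookup σ (crossingAt k))) (<⇒<ᵇ-true k<n)

  isA-toℕ : ∀ (i : Fin n) → isA (toℕ i) ≡ not (lookup σ i)
  isA-toℕ i = trans (isA-letter (toℕ i) (Finₚ.toℕ<n i)) (cong (not ∘ lookup σ) (crossingAt-toℕ i))

  #A : ℕ → ℕ
  #A g = sumBelow g (ind ∘ isA)

  totalA : ℕ
  totalA = #A n

  #A-B : ∀ k → isA k ≡ false → #A (suc k) ≡ #A k
  #A-B k e rewrite e = +-identityʳ (#A k)

  #A-A : ∀ k → isA k ≡ true → #A (suc k) ≡ suc (#A k)
  #A-A k e rewrite e = +-comm (#A k) 1

  #A-mono : ∀ {g h} → g ≤ h → #A g ≤ #A h
  #A-mono g≤h = go (≤⇒≤′ g≤h)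
    where
    go : ∀ {h} → _ ≤′ h → _ ≤ #A h
    go ≤′-refl = ≤-refl
    go (≤′-step {h} p) = ≤-trans (go p) (m≤m+n (#A h) _)

  isA⇒totalA-pos : ∀ k → isA k ≡ true → 1 ≤ totalA
  isA⇒totalA-pos k e = ≤-trans (subst (1 ≤_) (sym (#A-A k e)) (s≤s z≤n)) (#A-mono (isA⇒< k e))

  -- lastA g: the NE end of the last A-split left of gap g, or the NW end
  -- of c_1 if there is none.  It represents the top of gap g in T_n.
  lastA : ℕ → Vertex n
  lastA zero    = nw₀
  lastA (suc k) = if isA k then end k ne else lastA k

  lastA-shape : ∀ g → lastA g ≡ nw₀ ⊎ ∃[ j ] j < g × isA j ≡ true × lastA g ≡ end j ne
  lastA-shape zero = inj₁ refl
  lastA-shape (suc k) with isA k in e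
  ... | true = inj₂ (k , ≤-refl , e , refl)
  ... | false with lastA-shape k
  ...   | inj₁ q = inj₁ q
  ...   | inj₂ (j , j<k , aj , q) = inj₂ (j , m≤n⇒m≤1+n j<k , aj , q)

  lastA-B : ∀ k → isA k ≡ false → lastA (suc k) ≡ lastA k
  lastA-B k e rewrite e = refl

  lastA-A : ∀ k → isA k ≡ true → lastA (suc k) ≡ end k ne
  lastA-A k e rewrite e = refl

  lastA-none : ∀ g → #A g ≡ 0 → lastA g ≡ nw₀
  lastA-none zero _ = refl
  lastA-none (suc k) e with isA k
  ... | true  = ⊥-elim (1+n≢0 (trans (+-comm 1 (#A k)) e))
  ... | false = lastA-none k (trans (sym (+-identityʳ (#A k))) e)

  lastA-earlier : ∀ g X → (∀ j → j < g → rank j ne ≤ X) → ord (lastA g) ≤ X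
  lastA-earlier g X bound with lastA-shape g
  ... | inj₁ q rewrite q = z≤n
  ... | inj₂ (j , j<g , aj , q) rewrite q | toℕ-crossingAt j (isA⇒< j aj) = bound j j<g

  lastA-is-nw : ∀ (i : Fin n) → veq (lastA (toℕ i)) (i , nw) ≡ (toℕ i ≡ᵇ 0)
  lastA-is-nw i with lastA-shape (toℕ i)
  ... | inj₁ q rewrite q = trans (∧-identityʳ _) (≡ᵇ0-sym (toℕ i))
  ... | inj₂ (j , j<i , _ , q) rewrite q | ∧-zeroʳ (toℕ (crossingAt j) ≡ᵇ toℕ i) = sym (pos⇒≡ᵇ0-false (≤-<-trans z≤n j<i))

  lastA-is-ne : ∀ (i : Fin n) → veq (lastA (suc (toℕ i))) (i , ne) ≡ isA (toℕ i)
  lastA-is-ne i with isA (toℕ i) in a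
  ... | true rewrite crossingAt-toℕ i = veq-refl (i , ne)
  ... | false with lastA-shape (toℕ i)
  ...   | inj₁ q rewrite q = ∧-zeroʳ _
  ...   | inj₂ (j , j<i , aj , q) rewrite q | toℕ-crossingAt j (isA⇒< j aj)
                                           | ≢⇒≡ᵇ-false j (toℕ i) (<⇒≢ j<i) = refl

  lastA-not-sw : ∀ g (i : Fin n) → veq (lastA g) (i , sw) ≡ false
  lastA-not-sw g i with lastA-shape g
  ... | inj₁ q rewrite q = ∧-zeroʳ _
  ... | inj₂ (_ , _ , _ , q) rewrite q = ∧-zeroʳ _

  lastA-not-se : ∀ g (i : Fin n) → veq (lastA g) (i , se) ≡ false
  lastA-not-se g i with lastA-shape g
  ... | inj₁ q rewrite q = ∧-zeroʳ _
  ... | inj₂ (_ , _ , _ , q) rewrite q = ∧-zeroʳ _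

  -- Representatives determined by side and gap.  An end lies on the top
  -- side (NW, NE) or bottom side (SW, SE) of its crossing k, next to gap k
  -- (NW, SW) or gap k + 1 (NE, SE).
  isTop : End → Bool
  isTop nw = true
  isTop ne = true
  isTop sw = false
  isTop se = false

  gapOf : End → ℕ → ℕ
  gapOf nw k = k
  gapOf sw k = k
  gapOf ne k = suc k
  gapOf se k = suc k

  module SideRep (side : Bool → ℕ → Vertex n)
    (across-B : ∀ t k → isA k ≡ false → side t (suc k) ≡ side t k)
    (join-A : ∀ k → isA k ≡ true → side true k ≡ side false k × side true (suc k) ≡ side false (suc k))
    where

    rep : Vertex n → Vertex n
    rep (i , e) = side (isTop e) (gapOf e (toℕ i))

    region-arc : ∀ x y → (x , y) ∈ regionArcs n → rep x ≡ rep y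
    region-arc x y xy∈ with concatMap-∈⁻ _ (allFin n) xy∈
    ... | i , _ , xy∈i with concatMap-∈⁻ _ (allFin n) xy∈i
    ... | j , _ , xy∈ij with if-∈⁻ (toℕ j ≡ᵇ suc (toℕ i)) xy∈ij
    ... | j≡i+1 , xy∈′ with ≡ᵇ-true⇒≡ (toℕ j) (suc (toℕ i)) j≡i+1 | ∈-pair xy∈′
    ... | e | inj₁ refl = cong (side true) (sym e)
    ... | e | inj₂ refl = cong (side false) (sym e)

    split-arc : ∀ x y → (x , y) ∈ splitArcs σ → rep x ≡ rep y
    split-arc x y xy∈ with concatMap-∈⁻ _ (allFin n) xy∈
    ... | i , _ , xy∈i with lookup σ i | isA-toℕ i
    ... | true  | isB with ∈-pair xy∈i
    ...   | inj₁ refl = sym (across-B true  (toℕ i) isB)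
    ...   | inj₂ refl = sym (across-B false (toℕ i) isB)
    split-arc x y xy∈ | i , _ , xy∈i | false | isA′ with ∈-pair xy∈i
    ...   | inj₁ refl = proj₁ (join-A (toℕ i) isA′)
    ...   | inj₂ refl = proj₂ (join-A (toℕ i) isA′)

    inner-arc : ∀ x y → (x , y) ∈ regionArcs n ++ splitArcs σ → rep x ≡ rep y
    inner-arc x y xy∈ with ∈-++⁻ (regionArcs n) xy∈
    ... | inj₁ r = region-arc x y r
    ... | inj₂ s = split-arc x y s

  module State (closure : List (Edge n)) where

    arcs : List (Edge n)
    arcs = closure ++ regionArcs n ++ splitArcs σ

    open Reachability arcs public

    regionFromTo : Fin n → Fin n → List (Edge n)
    regionFromTo i j = if toℕ j ≡ᵇ suc (toℕ i) then ((i , ne) , (j , nw)) ∷ ((i , se) , (j , sw)) ∷ [] else []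

    splitAt : Fin n → List (Edge n)
    splitAt i = if lookup σ i
      then ((i , nw) , (i , ne)) ∷ ((i , sw) , (i , se)) ∷ []
      else ((i , nw) , (i , sw)) ∷ ((i , ne) , (i , se)) ∷ []

    region-∈ : ∀ {x} → x ∈ regionArcs n → x ∈ arcs
    region-∈ m = ∈-++⁺ʳ closure (∈-++⁺ˡ m)

    split-∈ : ∀ {x} → x ∈ splitArcs σ → x ∈ arcs
    split-∈ m = ∈-++⁺ʳ closure (∈-++⁺ʳ (regionArcs n) m)

    region-arcs : ∀ k → suc k < n →
      (end k ne , end (suc k) nw) ∈ arcs × (end k se , end (suc k) sw) ∈ arcs
    region-arcs k k+1<n = region-∈ (arc (here refl)) , region-∈ (arc (there (here refl)))
      where
      consecutive : (toℕ (crossingAt (suc k)) ≡ᵇ suc (toℕ (crossingAt k))) ≡ true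
      consecutive rewrite toℕ-crossingAt (suc k) k+1<n | toℕ-crossingAt k (<-trans (n<1+n k) k+1<n) = ≡ᵇ-refl k
      arc : ∀ {x} → x ∈ (((crossingAt k , ne) , (crossingAt (suc k) , nw)) ∷
                         ((crossingAt k , se) , (crossingAt (suc k) , sw)) ∷ []) → x ∈ regionArcs n
      arc m = concatMap-∈⁺ (λ i → concatMap (regionFromTo i) (allFin n)) (∈-allFin (crossingAt k))
                (concatMap-∈⁺ (regionFromTo (crossingAt k)) (∈-allFin (crossingAt (suc k))) (if-∈⁺ (inj₁ (consecutive , m))))

    B-arcs : ∀ k → k < n → isA k ≡ false →
      (end k nw , end k ne) ∈ arcs × (end k sw , end k se) ∈ arcs
    B-arcs k k<n b = split-∈ (arc (here refl)) , split-∈ (arc (there (here refl)))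
      where
      letter : lookup σ (crossingAt k) ≡ true
      letter = not-injective (trans (sym (isA-letter k k<n)) b)
      arc : ∀ {x} → x ∈ (((crossingAt k , nw) , (crossingAt k , ne)) ∷ ((crossingAt k , sw) , (crossingAt k , se)) ∷ []) →
        x ∈ splitArcs σ
      arc m = concatMap-∈⁺ splitAt (∈-allFin (crossingAt k)) (if-∈⁺ (inj₁ (letter , m)))

    A-arcs : ∀ k → isA k ≡ true →
      (end k nw , end k sw) ∈ arcs × (end k ne , end k se) ∈ arcs
    A-arcs k a = split-∈ (arc (here refl)) , split-∈ (arc (there (here refl)))
      where
      letter : lookup σ (crossingAt k) ≡ false
      letter = not-injective (trans (sym (isA-letter k (isA⇒< k a))) a)
      arc : ∀ {x} → x ∈ (((crossingAt k , nw) , (crossingAt k , sw)) ∷ ((crossingAt k , ne) , (crossingAt k , se)) ∷ []) →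
        x ∈ splitArcs σ
      arc m = concatMap-∈⁺ splitAt (∈-allFin (crossingAt k)) (if-∈⁺ (inj₂ (letter , m)))

    -- Walking left along the top strand: an end at gap g on the top side is
    -- connected to lastA g (B-splits pass the top strand on to the left,
    -- the NE end of an A-split is lastA itself).
    top-nw : ∀ k → k < n → Connected (end k nw) (lastA k)
    top-ne : ∀ k → k < n → Connected (end k ne) (lastA (suc k))
    top-nw zero    _     = connected-refl _
    top-nw (suc k) k+1<n = connected-trans (arc→connected′ (proj₁ (region-arcs k k+1<n)))
                                           (top-ne k (<-trans (n<1+n k) k+1<n))
    top-ne k k<n with isA k in a
    ... | true  = connected-refl _
    ... | false = connected-trans (arc→connected′ (proj₁ (B-arcs k k<n a))) (top-nw k k<n)

    -- Walking left along the bottom strand reaches lastA g as well, provided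
    -- it can cross to the top: at gap 0 (if SW of c_1 is joined to NW of c_1)
    -- or at an A-split left of the gap.
    BottomJoinsTop : ℕ → Set
    BottomJoinsTop g = Connected (end 0 sw) nw₀ ⊎ 1 ≤ #A g

    bottom-sw : ∀ k → k < n → BottomJoinsTop k → Connected (end k sw) (lastA k)
    bottom-se : ∀ k → k < n → BottomJoinsTop (suc k) → Connected (end k se) (lastA (suc k))
    bottom-sw zero    _     (inj₁ c) = c
    bottom-sw zero    _     (inj₂ ())
    bottom-sw (suc k) k+1<n joins    = connected-trans (arc→connected′ (proj₂ (region-arcs k k+1<n)))
                                         (bottom-se k (<-trans (n<1+n k) k+1<n) joins)
    bottom-se k k<n joins = by-split (isA k) refl
      where
      by-split : ∀ b → isA k ≡ b → Connected (end k se) (lastA (suc k))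
      by-split true  a rewrite a = arc→connected′ (proj₂ (A-arcs k a))
      by-split false b rewrite lastA-B k b =
        connected-trans (arc→connected′ (proj₂ (B-arcs k k<n b))) (bottom-sw k k<n (joins′ joins))
        where
        joins′ : BottomJoinsTop (suc k) → BottomJoinsTop k
        joins′ (inj₁ c) = inj₁ c
        joins′ (inj₂ some) = inj₂ (subst (1 ≤_) (#A-B k b) some)

-- The n-twist loop T_n: the closure joins NW–SW of c_1 and NE–SE of c_n.
-- Both sides of every gap are represented by lastA, so T_n has one circle
-- per A-split plus one.
module Twist (m : ℕ) (σ : Vec Bool (suc m)) where
  open Word m σ
  open State (twistClosure n)

  leftClosure rightClosure : Fin n → List (Edge n)
  leftClosure  i = if toℕ i ≡ᵇ 0 then ((i , nw) , (i , sw)) ∷ [] else []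
  rightClosure i = if toℕ i ≡ᵇ (n ∸ 1) then ((i , ne) , (i , se)) ∷ [] else []

  closure-left : (nw₀ , end 0 sw) ∈ arcs
  closure-left = ∈-++⁺ˡ (∈-++⁺ˡ (concatMap-∈⁺ leftClosure (∈-allFin Fin.zero) (here refl)))

  open SideRep (λ _ → lastA) (λ _ k b → lastA-B k b) (λ _ _ → refl , refl)

  closure-arc : ∀ x y → (x , y) ∈ twistClosure n → rep x ≡ rep y
  closure-arc x y xy∈ with ∈-++⁻ (concatMap leftClosure (allFin n)) xy∈
  ... | inj₁ left with concatMap-∈⁻ leftClosure (allFin n) left
  ...   | i , _ , xy∈i with if-∈⁻ (toℕ i ≡ᵇ 0) xy∈i
  ...     | _ , here refl = refl
  closure-arc x y xy∈ | inj₂ right with concatMap-∈⁻ rightClosure (allFin n) right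
  ...   | i , _ , xy∈i with if-∈⁻ (toℕ i ≡ᵇ (n ∸ 1)) xy∈i
  ...     | _ , here refl = refl

  rep-lastA : ∀ g → rep (lastA g) ≡ lastA g
  rep-lastA g with lastA-shape g
  ... | inj₁ q rewrite q = refl
  ... | inj₂ (j , _ , aj , q) rewrite q | toℕ-crossingAt j (isA⇒< j aj) | aj = refl

  representatives : Representatives arcs
  representatives = record
    { rep           = rep
    ; rep-arc       = λ x y xy∈ → [ closure-arc x y , inner-arc x y ]′ (∈-++⁻ (twistClosure n) xy∈)
    ; rep-idem      = λ { (i , e) → rep-lastA (gapOf e (toℕ i)) }
    ; rep-connected = connects
    ; rep-earlier   = earlier
    }
    where
    connects : ∀ v → Connected v (rep v)
    connects (i , e) = subst (λ c → Connected (c , e) (rep (i , e))) (crossingAt-toℕ i) (walk e)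
      where
      i<n : toℕ i < n
      i<n = Finₚ.toℕ<n i
      walk : ∀ e → Connected (end (toℕ i) e) (rep (i , e))
      walk nw = top-nw (toℕ i) i<n
      walk ne = top-ne (toℕ i) i<n
      walk sw = bottom-sw (toℕ i) i<n (inj₁ (arc→connected′ closure-left))
      walk se = bottom-se (toℕ i) i<n (inj₁ (arc→connected′ closure-left))
    earlier : ∀ v → ord (rep v) ≤ ord v
    earlier (i , nw) = lastA-earlier (toℕ i) _ (λ j j<i → <⇒≤ (rank-<-crossing ne nw j<i))
    earlier (i , sw) = lastA-earlier (toℕ i) _ (λ j j<i → <⇒≤ (rank-<-crossing ne sw j<i))
    earlier (i , ne) = lastA-earlier (suc (toℕ i)) _ (λ j j≤i → rank-ne≤ ne (s≤s⁻¹ j≤i) (s≤s z≤n))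
    earlier (i , se) = lastA-earlier (suc (toℕ i)) _ (λ j j≤i → rank-ne≤ se (s≤s⁻¹ j≤i) (s≤s z≤n))

  open Representatives representatives using (isRep)

  fixed-at : ∀ i → countAt isRep i ≡ ind (toℕ i ≡ᵇ 0) + ind (isA (toℕ i))
  fixed-at i rewrite lastA-is-nw i | lastA-is-ne i
                   | lastA-not-sw (toℕ i) i | lastA-not-se (suc (toℕ i)) i =
    cong (ind (toℕ i ≡ᵇ 0) +_) (+-identityʳ (ind (isA (toℕ i))))

  twist-components : components (twistState σ) ≡ suc totalA
  twist-components = begin
    components arcs                                                ≡⟨ components-by-representatives representatives ⟩
    length (filter isRep (vertices n))                             ≡⟨ count-by-crossings isRep _ fixed-at ⟩
    sumBelow n (λ t → ind (t ≡ᵇ 0) + ind (isA t))                  ≡⟨ sumBelow-+ n _ _ ⟩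
    sumBelow n (λ t → ind (t ≡ᵇ 0)) + totalA                       ≡⟨ cong (_+ totalA) (sumBelow-is-zero m) ⟩
    suc totalA                                                     ∎
    where open ≡-Reasoning

-- The n-foil F_n: the closure joins NW of c_1 to NE of c_n and SW of c_1
-- to SE of c_n, so gap n is glued to gap 0 on each side.
module Foil (m : ℕ) (σ : Vec Bool (suc m)) where
  open Word m σ
  open State (foilClosure n)

  laterA : ℕ → Bool
  laterA g = #A g <ᵇ totalA

  -- Gaps right of the last A-split wrap round through the closure to gap 0,
  -- where the top is represented by NW of c_1.  The bottom meets the top at
  -- any A-split; without A-splits it is a circle of its own, through SW of c_1.
  topRep bottomRep : ℕ → Vertex n
  topRep    g = if laterA g then lastA g else nw₀
  bottomRep g = if laterA g then lastA g else (if laterA 0 then nw₀ else sw₀)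

  side : Bool → ℕ → Vertex n
  side true  = topRep
  side false = bottomRep

  across-B : ∀ t k → isA k ≡ false → side t (suc k) ≡ side t k
  across-B true  k b rewrite #A-B k b | lastA-B k b = refl
  across-B false k b rewrite #A-B k b | lastA-B k b = refl

  sides-agree : laterA 0 ≡ true → ∀ g → topRep g ≡ bottomRep g
  sides-agree some g rewrite some with laterA g
  ... | true  = refl
  ... | false = refl

  join-A : ∀ k → isA k ≡ true → topRep k ≡ bottomRep k × topRep (suc k) ≡ bottomRep (suc k)
  join-A k a = sides-agree some k , sides-agree some (suc k)
    where
    some : laterA 0 ≡ true
    some = <⇒<ᵇ-true (isA⇒totalA-pos k a)

  open SideRep side across-B join-A

  -- Both closure arcs join gap 0 to gap n, where no A-split lies to the right.
  top-wraps : topRep n ≡ topRep 0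
  top-wraps rewrite <ᵇ-irrefl totalA with laterA 0
  ... | true  = refl
  ... | false = refl

  bottom-wraps : bottomRep n ≡ bottomRep 0
  bottom-wraps rewrite <ᵇ-irrefl totalA with laterA 0
  ... | true  = refl
  ... | false = refl

  closureBetween : Fin n → Fin n → List (Edge n)
  closureBetween i j = if (toℕ i ≡ᵇ 0) ∧ (toℕ j ≡ᵇ (n ∸ 1)) then ((i , nw) , (j , ne)) ∷ ((i , sw) , (j , se)) ∷ [] else []

  closure-arc : ∀ x y → (x , y) ∈ foilClosure n → rep x ≡ rep y
  closure-arc x y xy∈ with concatMap-∈⁻ _ (allFin n) xy∈
  ... | i , _ , xy∈i with concatMap-∈⁻ (closureBetween i) (allFin n) xy∈i
  ... | j , _ , xy∈ij with if-∈⁻ ((toℕ i ≡ᵇ 0) ∧ (toℕ j ≡ᵇ (n ∸ 1))) xy∈ij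
  ... | ends , xy∈′ with ∧-true⁻ {toℕ i ≡ᵇ 0} ends
  ... | i≡0 , j≡m with ≡ᵇ-true⇒≡ (toℕ i) 0 i≡0 | ≡ᵇ-true⇒≡ (toℕ j) m j≡m | ∈-pair xy∈′
  ... | i≡0′ | j≡m′ | inj₁ refl = trans (cong topRep i≡0′) (sym (trans (cong (topRep ∘ suc) j≡m′) top-wraps))
  ... | i≡0′ | j≡m′ | inj₂ refl = trans (cong bottomRep i≡0′) (sym (trans (cong (bottomRep ∘ suc) j≡m′) bottom-wraps))

  closure-∈ : (nw₀ , end m ne) ∈ arcs × (sw₀ , end m se) ∈ arcs
  closure-∈ = closure (here refl) , closure (there (here refl))
    where
    ends : ((toℕ (Fin.zero {m}) ≡ᵇ 0) ∧ (toℕ (crossingAt m) ≡ᵇ (n ∸ 1))) ≡ true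
    ends rewrite toℕ-crossingAt m ≤-refl = ≡ᵇ-refl m
    closure : ∀ {x} → x ∈ ((nw₀ , end m ne) ∷ (sw₀ , end m se) ∷ []) → x ∈ arcs
    closure p = ∈-++⁺ˡ (concatMap-∈⁺ (λ i → concatMap (closureBetween i) (allFin n)) (∈-allFin Fin.zero)
                  (concatMap-∈⁺ (closureBetween Fin.zero) (∈-allFin (crossingAt m)) (if-∈⁺ (inj₁ (ends , p)))))

  topRep-cases : ∀ g → (laterA g ≡ true × topRep g ≡ lastA g) ⊎ (laterA g ≡ false × topRep g ≡ nw₀)
  topRep-cases g with laterA g
  ... | true  = inj₁ (refl , refl)
  ... | false = inj₂ (refl , refl)

  bottomRep-cases : ∀ g → (laterA g ≡ true × bottomRep g ≡ lastA g)
                        ⊎ (laterA g ≡ false × laterA 0 ≡ true × bottomRep g ≡ nw₀)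
                        ⊎ (laterA g ≡ false × laterA 0 ≡ false × bottomRep g ≡ sw₀)
  bottomRep-cases g with laterA g | laterA 0
  ... | true  | _     = inj₁ (refl , refl)
  ... | false | true  = inj₂ (inj₁ (refl , refl , refl))
  ... | false | false = inj₂ (inj₂ (refl , refl , refl))

  rep-nw₀ : rep nw₀ ≡ nw₀
  rep-nw₀ with laterA 0
  ... | true  = refl
  ... | false = refl

  rep-lastA : ∀ g → laterA g ≡ true → rep (lastA g) ≡ lastA g
  rep-lastA g later with lastA-shape g
  ... | inj₁ q rewrite q = rep-nw₀
  ... | inj₂ (j , j<g , aj , q) rewrite q | toℕ-crossingAt j (isA⇒< j aj) | lastA-A j aj
    | <⇒<ᵇ-true {#A (suc j)} {totalA} (≤-<-trans (#A-mono j<g) (<ᵇ-true⇒< _ _ later)) = refl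

  rep-topRep : ∀ g → rep (topRep g) ≡ topRep g
  rep-topRep g with topRep-cases g
  ... | inj₁ (later , q) rewrite q = rep-lastA g later
  ... | inj₂ (_ , q)     rewrite q = rep-nw₀

  rep-bottomRep : ∀ g → rep (bottomRep g) ≡ bottomRep g
  rep-bottomRep g with bottomRep-cases g
  ... | inj₁ (later , q)                  rewrite q = rep-lastA g later
  ... | inj₂ (inj₁ (_ , _ , q))           rewrite q = rep-nw₀
  ... | inj₂ (inj₂ (_ , none , q))        rewrite q | none = refl

  topRep-earlier : ∀ g X → (∀ j → j < g → rank j ne ≤ X) → ord (topRep g) ≤ X
  topRep-earlier g X bound with topRep-cases g
  ... | inj₁ (_ , q) rewrite q = lastA-earlier g X bound
  ... | inj₂ (_ , q) rewrite q = z≤n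

  bottomRep-earlier : ∀ g X → (∀ j → j < g → rank j ne ≤ X) → 2 ≤ X → ord (bottomRep g) ≤ X
  bottomRep-earlier g X bound 2≤X with bottomRep-cases g
  ... | inj₁ (_ , q)               rewrite q = lastA-earlier g X bound
  ... | inj₂ (inj₁ (_ , _ , q))    rewrite q = z≤n
  ... | inj₂ (inj₂ (_ , _ , q))    rewrite q = 2≤X

  -- Walking right: past the last A-split both strands run through c_n and
  -- the closure back to c_1; before the first A-split the bottom strand
  -- runs right to that A-split and crosses to the top.
  last-gap : ∀ k → k < n → #A k ≡ totalA → isA k ≡ false
  last-gap k k<n all with isA k in a
  ... | false = refl
  ... | true  = ⊥-elim (1+n≰n (subst (λ t → suc t ≤ totalA) all (subst (_≤ totalA) (#A-A k a) (#A-mono k<n))))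

  rest⇒<n : ∀ d k → d + k ≡ m → k < n
  rest⇒<n d k d+k≡m = s≤s (subst (k ≤_) d+k≡m (m≤n+m k d))

  rest⇒suc<n : ∀ d k → suc d + k ≡ m → suc k < n
  rest⇒suc<n d k d+k≡m = s≤s (subst (suc k ≤_) d+k≡m (s≤s (m≤n+m k d)))

  wrap-nw : ∀ d k → d + k ≡ m → #A k ≡ totalA → Connected (end k nw) nw₀
  wrap-ne : ∀ d k → d + k ≡ m → #A (suc k) ≡ totalA → Connected (end k ne) nw₀
  wrap-nw d k d+k≡m all = connected-trans (arc→connected (proj₁ (B-arcs k k<n b))) (wrap-ne d k d+k≡m (trans (#A-B k b) all))
    where
    k<n : k < n
    k<n = rest⇒<n d k d+k≡m
    b : isA k ≡ false
    b = last-gap k k<n all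
  wrap-ne zero    k k≡m _   = subst (λ j → Connected (end j ne) nw₀) (sym k≡m) (arc→connected′ (proj₁ closure-∈))
  wrap-ne (suc d) k d+k≡m all = connected-trans (arc→connected (proj₁ (region-arcs k (rest⇒suc<n d k d+k≡m))))
                                                (wrap-nw d (suc k) (trans (+-suc d k) d+k≡m) all)

  wrap-sw : ∀ d k → d + k ≡ m → #A k ≡ totalA → Connected (end k sw) sw₀
  wrap-se : ∀ d k → d + k ≡ m → #A (suc k) ≡ totalA → Connected (end k se) sw₀
  wrap-sw d k d+k≡m all = connected-trans (arc→connected (proj₂ (B-arcs k k<n b))) (wrap-se d k d+k≡m (trans (#A-B k b) all))
    where
    k<n : k < n
    k<n = rest⇒<n d k d+k≡m
    b : isA k ≡ false
    b = last-gap k k<n all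
  wrap-se zero    k k≡m _   = subst (λ j → Connected (end j se) sw₀) (sym k≡m) (arc→connected′ (proj₂ closure-∈))
  wrap-se (suc d) k d+k≡m all = connected-trans (arc→connected (proj₂ (region-arcs k (rest⇒suc<n d k d+k≡m))))
                                                (wrap-sw d (suc k) (trans (+-suc d k) d+k≡m) all)

  first-sw : ∀ d k → d + k ≡ m → #A k ≡ 0 → 0 < totalA → Connected (end k sw) nw₀
  first-se : ∀ d k → d + k ≡ m → #A (suc k) ≡ 0 → 0 < totalA → Connected (end k se) nw₀
  first-sw d k d+k≡m none some with isA k in a
  ... | true  = connected-trans (arc→connected′ (proj₁ (A-arcs k a)))
                  (subst (Connected (end k nw)) (lastA-none k none) (top-nw k (rest⇒<n d k d+k≡m)))
  ... | false = connected-trans (arc→connected (proj₂ (B-arcs k (rest⇒<n d k d+k≡m) a)))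
                  (first-se d k d+k≡m (trans (#A-B k a) none) some)
  first-se zero    k k≡m none some = ⊥-elim (<-irrefl (sym (subst (λ j → #A (suc j) ≡ 0) k≡m none)) some)
  first-se (suc d) k d+k≡m none some = connected-trans (arc→connected (proj₂ (region-arcs k (rest⇒suc<n d k d+k≡m))))
                                                       (first-sw d (suc k) (trans (+-suc d k) d+k≡m) none some)

  bottom-joins-top : 0 < totalA → Connected sw₀ nw₀
  bottom-joins-top some = first-sw m 0 (+-identityʳ m) refl some

  no-later : ∀ g → g ≤ n → laterA g ≡ false → #A g ≡ totalA
  no-later g g≤n c = ≤-antisym (#A-mono g≤n) (<ᵇ-false⇒≥ _ _ c)

  -- Left of the last A-split the bottom strand reaches lastA: walking left
  -- if an A-split lies left of the gap, walking right to the first one otherwise.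
  bottom-sw-later : ∀ d t → d + t ≡ m → laterA t ≡ true → Connected (end t sw) (lastA t)
  bottom-sw-later d t d+t≡m later with #A t in count
  ... | zero  = subst (Connected (end t sw)) (sym (lastA-none t count))
                  (first-sw d t d+t≡m count (<ᵇ-true⇒< _ _ later))
  ... | suc _ = bottom-sw t (rest⇒<n d t d+t≡m) (inj₂ (subst (1 ≤_) (sym count) (s≤s z≤n)))

  bottom-se-later : ∀ d t → d + t ≡ m → laterA (suc t) ≡ true → Connected (end t se) (lastA (suc t))
  bottom-se-later d t d+t≡m later with #A (suc t) in count
  ... | zero  = subst (Connected (end t se)) (sym (lastA-none (suc t) count))
                  (first-se d t d+t≡m count (<ᵇ-true⇒< _ _ later))
  ... | suc _ = bottom-se t (rest⇒<n d t d+t≡m) (inj₂ (subst (1 ≤_) (sym count) (s≤s z≤n)))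

  connects : ∀ v → Connected v (rep v)
  connects (i , e) = subst (λ c → Connected (c , e) (rep (i , e))) (crossingAt-toℕ i) (walk e)
    where
    t : ℕ
    t = toℕ i
    t<n : t < n
    t<n = Finₚ.toℕ<n i
    d : ℕ
    d = m ∸ t
    d+t≡m : d + t ≡ m
    d+t≡m = m∸n+n≡m (s≤s⁻¹ t<n)
    walk : ∀ e → Connected (end t e) (rep (i , e))
    walk nw with topRep-cases t
    ... | inj₁ (_ , q) = subst (Connected (end t nw)) (sym q) (top-nw t t<n)
    ... | inj₂ (c , q) = subst (Connected (end t nw)) (sym q) (wrap-nw d t d+t≡m (no-later t (<⇒≤ t<n) c))
    walk ne with topRep-cases (suc t)
    ... | inj₁ (_ , q) = subst (Connected (end t ne)) (sym q) (top-ne t t<n)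
    ... | inj₂ (c , q) = subst (Connected (end t ne)) (sym q) (wrap-ne d t d+t≡m (no-later (suc t) t<n c))
    walk sw with bottomRep-cases t
    ... | inj₁ (later , q) = subst (Connected (end t sw)) (sym q) (bottom-sw-later d t d+t≡m later)
    ... | inj₂ (inj₁ (c , some , q)) = subst (Connected (end t sw)) (sym q)
            (connected-trans (wrap-sw d t d+t≡m (no-later t (<⇒≤ t<n) c)) (bottom-joins-top (<ᵇ-true⇒< _ _ some)))
    ... | inj₂ (inj₂ (c , _ , q)) = subst (Connected (end t sw)) (sym q) (wrap-sw d t d+t≡m (no-later t (<⇒≤ t<n) c))
    walk se with bottomRep-cases (suc t)
    ... | inj₁ (later , q) = subst (Connected (end t se)) (sym q) (bottom-se-later d t d+t≡m later)
    ... | inj₂ (inj₁ (c , some , q)) = subst (Connected (end t se)) (sym q)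
            (connected-trans (wrap-se d t d+t≡m (no-later (suc t) t<n c)) (bottom-joins-top (<ᵇ-true⇒< _ _ some)))
    ... | inj₂ (inj₂ (c , _ , q)) = subst (Connected (end t se)) (sym q) (wrap-se d t d+t≡m (no-later (suc t) t<n c))

  earlier : ∀ v → ord (rep v) ≤ ord v
  earlier (i , nw) = topRep-earlier (toℕ i) _ (λ j j<i → <⇒≤ (rank-<-crossing ne nw j<i))
  earlier (i , ne) = topRep-earlier (suc (toℕ i)) _ (λ j j≤i → rank-ne≤ ne (s≤s⁻¹ j≤i) (s≤s z≤n))
  earlier (i , sw) = bottomRep-earlier (toℕ i) _ (λ j j<i → <⇒≤ (rank-<-crossing ne sw j<i))
                       (m≤n+m 2 (toℕ i * 4))
  earlier (i , se) = bottomRep-earlier (suc (toℕ i)) _ (λ j j≤i → rank-ne≤ se (s≤s⁻¹ j≤i) (s≤s z≤n))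
                       (≤-trans (n≤1+n 2) (m≤n+m 3 (toℕ i * 4)))

  representatives : Representatives arcs
  representatives = record
    { rep           = rep
    ; rep-arc       = λ x y xy∈ → [ closure-arc x y , inner-arc x y ]′ (∈-++⁻ (foilClosure n) xy∈)
    ; rep-idem      = idem
    ; rep-connected = connects
    ; rep-earlier   = earlier
    }
    where
    idem : ∀ v → rep (rep v) ≡ rep v
    idem (i , nw) = rep-topRep (toℕ i)
    idem (i , ne) = rep-topRep (suc (toℕ i))
    idem (i , sw) = rep-bottomRep (toℕ i)
    idem (i , se) = rep-bottomRep (suc (toℕ i))

  open Representatives representatives using (isRep)

  notLastA : ℕ → Bool
  notLastA t = laterA (suc t) ∧ isA t

  noA : Bool
  noA = totalA ≡ᵇ 0

  fixed-nw : ∀ i → isRep (i , nw) ≡ (toℕ i ≡ᵇ 0)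
  fixed-nw i with topRep-cases (toℕ i)
  ... | inj₁ (_ , q) rewrite q = lastA-is-nw i
  ... | inj₂ (_ , q) rewrite q = trans (∧-identityʳ _) (≡ᵇ0-sym (toℕ i))

  fixed-ne : ∀ i → isRep (i , ne) ≡ notLastA (toℕ i)
  fixed-ne i with topRep-cases (suc (toℕ i))
  ... | inj₁ (later , q) rewrite q | later = lastA-is-ne i
  ... | inj₂ (later , q) rewrite q | later = ∧-zeroʳ _

  fixed-sw : ∀ i → isRep (i , sw) ≡ ((toℕ i ≡ᵇ 0) ∧ noA)
  fixed-sw i with bottomRep-cases (toℕ i)
  ... | inj₁ (later , q) rewrite q | lastA-not-sw (toℕ i) i
    | pos⇒≡ᵇ0-false {totalA} (≤-<-trans z≤n (<ᵇ-true⇒< _ _ later)) = sym (∧-zeroʳ _)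
  ... | inj₂ (inj₁ (_ , some , q)) rewrite q
    | pos⇒≡ᵇ0-false {totalA} (<ᵇ-true⇒< _ _ some) = trans (∧-zeroʳ _) (sym (∧-zeroʳ _))
  ... | inj₂ (inj₂ (_ , none , q)) rewrite q
    | ≤-antisym (<ᵇ-false⇒≥ 0 totalA none) z≤n = cong (_∧ true) (≡ᵇ0-sym (toℕ i))

  fixed-se : ∀ i → isRep (i , se) ≡ false
  fixed-se i with bottomRep-cases (suc (toℕ i))
  ... | inj₁ (_ , q)            rewrite q = lastA-not-se (suc (toℕ i)) i
  ... | inj₂ (inj₁ (_ , _ , q)) rewrite q = ∧-zeroʳ _
  ... | inj₂ (inj₂ (_ , _ , q)) rewrite q = ∧-zeroʳ _

  fixed-at : ∀ i → countAt isRep i ≡ ind (toℕ i ≡ᵇ 0) + (ind (notLastA (toℕ i)) + ind ((toℕ i ≡ᵇ 0) ∧ noA))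
  fixed-at i rewrite fixed-nw i | fixed-ne i | fixed-sw i | fixed-se i =
    cong (λ k → ind (toℕ i ≡ᵇ 0) + (ind (notLastA (toℕ i)) + k)) (+-identityʳ _)

  first-crossing-only : ∀ b → sumBelow n (λ t → ind ((t ≡ᵇ 0) ∧ b)) ≡ ind b
  first-crossing-only true  = trans (sumBelow-cong n (λ t → cong ind (∧-identityʳ (t ≡ᵇ 0)))) (sumBelow-is-zero m)
  first-crossing-only false = sumBelow-zero n (λ t → cong ind (∧-zeroʳ (t ≡ᵇ 0)))

  foil-components : components (foilState σ) ≡ suc (sumBelow n (ind ∘ notLastA) + ind noA)
  foil-components = begin
    components arcs
      ≡⟨ components-by-representatives representatives ⟩
    length (filter isRep (vertices n))
      ≡⟨ count-by-crossings isRep _ fixed-at ⟩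
    sumBelow n (λ t → ind (t ≡ᵇ 0) + (ind (notLastA t) + ind ((t ≡ᵇ 0) ∧ noA)))
      ≡⟨ sumBelow-+ n _ _ ⟩
    sumBelow n (λ t → ind (t ≡ᵇ 0)) + sumBelow n (λ t → ind (notLastA t) + ind ((t ≡ᵇ 0) ∧ noA))
      ≡⟨ cong₂ _+_ (sumBelow-is-zero m) (sumBelow-+ n _ _) ⟩
    suc (sumBelow n (ind ∘ notLastA) + sumBelow n (λ t → ind ((t ≡ᵇ 0) ∧ noA)))
      ≡⟨ cong (λ k → suc (sumBelow n (ind ∘ notLastA) + k)) (first-crossing-only noA) ⟩
    suc (sumBelow n (ind ∘ notLastA) + ind noA) ∎
    where open ≡-Reasoning

  -- With exactly one A-split, it is the last one and F_n is a single circle.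
  one-A⇒one-circle : totalA ≡ 1 → components (foilState σ) ≡ 1
  one-A⇒one-circle one = trans foil-components
    (cong suc (cong₂ _+_ (sumBelow-zero n (λ t → cong ind (last-only t (isA t) refl))) (cong (ind ∘ (_≡ᵇ 0)) one)))
    where
    last-only : ∀ t b → isA t ≡ b → notLastA t ≡ false
    last-only t false b = trans (cong (laterA (suc t) ∧_) b) (∧-zeroʳ _)
    last-only t true  a = cong (_∧ isA t) none-later
      where
      none-later : laterA (suc t) ≡ false
      none-later = ≥⇒<ᵇ-false (subst (totalA ≤_) (sym (#A-A t a)) (subst (_≤ suc (#A t)) (sym one) (s≤s z≤n)))

  first-not-last : 2 ≤ totalA → ∀ g → 1 ≤ #A g → 1 ≤ sumBelow g (ind ∘ notLastA)
  first-not-last two (suc g) some = by-count (#A g) refl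
    where
    first-counts : #A g ≡ 0 → ∀ b → isA g ≡ b → 1 ≤ ind (notLastA g)
    first-counts none true a = subst (λ x → 1 ≤ ind x) (sym (cong₂ _∧_ later a)) (s≤s z≤n)
      where
      later : laterA (suc g) ≡ true
      later = <⇒<ᵇ-true (subst (_< totalA) (sym (trans (#A-A g a) (cong suc none))) two)
    first-counts none false b = ⊥-elim (1+n≰n (subst (1 ≤_) (trans (#A-B g b) none) some))
    by-count : ∀ k → #A g ≡ k → 1 ≤ sumBelow (suc g) (ind ∘ notLastA)
    by-count (suc _) count = ≤-trans (first-not-last two g (subst (1 ≤_) (sym count) (s≤s z≤n))) (m≤m+n _ _)
    by-count zero    none  = ≤-trans (first-counts none (isA g) refl) (m≤n+m _ _)

  one-circle⇒one-A : components (foilState σ) ≡ 1 → totalA ≡ 1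
  one-circle⇒one-A one = by-count totalA refl
    where
    nothing-extra : sumBelow n (ind ∘ notLastA) + ind noA ≡ 0
    nothing-extra = suc-injective (trans (sym foil-components) one)
    by-count : ∀ k → totalA ≡ k → totalA ≡ 1
    by-count zero          none = ⊥-elim (1+n≢0 (subst (λ k → ind (k ≡ᵇ 0) ≡ 0) none (m+n≡0⇒n≡0 _ nothing-extra)))
    by-count (suc zero)    one′ = one′
    by-count (suc (suc k)) many = ⊥-elim (1+n≰n (subst (1 ≤_) (m+n≡0⇒m≡0 _ nothing-extra)
      (first-not-last two n (≤-trans (s≤s z≤n) two))))
      where
      two : 2 ≤ totalA
      two = subst (2 ≤_) (sym many) (s≤s (s≤s z≤n))

-- Both sides of the equivalence say that σ has exactly one A-split.
mainTheorem18 : (n : ℕ) → 1 ≤ n → (σ : Vec Bool n) →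
    (components (foilState σ) ≡ 1 ⇔ components (twistState σ) ≡ 2)
mainTheorem18 (suc m) _ σ = mk⇔
  (λ foil-one  → trans (Twist.twist-components m σ) (cong suc (Foil.one-circle⇒one-A m σ foil-one)))
  (λ twist-two → Foil.one-A⇒one-circle m σ (suc-injective (trans (sym (Twist.twist-components m σ)) twist-two)))
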